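{- Let $\mathcal{M}=(S,Act,\bar s,\mathbf{P})$ be an MDP and $\mathcal{D}$ a partition of $S$. Then $\mathcal{D}=\mathcal{D}_{\mathsf{MEC}}$ if and only if there exists a MEC certificate for $\mathcal{D}$, i.e. a pair consisting of (i) an EC certificate for every class $D\in\mathcal{D}$ and (ii) a vector $\mathtt{r}\in\mathbb{N}^{\mathcal{D}}$ such that $\mathtt{r}([s]_{\mathcal{D}})\geq 1+\min_{s'\in\mathrm{supp}(\mathbf{P}(s,a))}\mathtt{r}([s']_{\mathcal{D}})$ for all $(s,a)\in\mathsf{En}_{\mathcal{D}}$.
   Context: An MDP $(S,Act,\bar s,\mathbf{P})$ has finite $S$, $Act$, initial state $\bar s$, partial transition function $\mathbf{P}:S\times Act\to\mathrm{Dist}(S)$; $\mathbf{P}(s,a,T)=\sum_{t\in T}\mathbf{P}(s,a)(t)$; $\mathsf{En}$ is the set of pairs $(s,a)$ with $\mathbf{P}(s,a)$ defined, $Act(s)$ the enabled actions at $s$, $\mathrm{supp}(\mathbf{P}(s,a))=\{s'\mid\mathbf{P}(s,a,s')>0\}$. An end component (EC) is a nonempty $\mathcal{E}\subseteq\mathsf{En}$ such that, with $S(\mathcal{E})$ the states occurring in $\mathcal{E}$, $\mathbf{P}(s,a,S(\mathcal{E}))=1$ for all $(s,a)\in\mathcal{E}$ and the graph on $S(\mathcal{E})$ with edges $s\to s'$ when $\mathbf{P}(s,a,s')>0$ for some $(s,a)\in\mathcal{E}$ is strongly connected; a MEC is an inclusion-maximal EC. $\mathcal{D}_{\mathsf{MEC}}$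 is the partition of $S$ into state sets of MECs and singletons $\{s\}$ for states in no MEC. For a partition $\mathcal{D}$, $[s]_{\mathcal{D}}$ is the class of $s$ and $\mathsf{En}_{\mathcal{D}}=\{(s,a)\in\mathsf{En}\mid\mathbf{P}(s,a,[s]_{\mathcal{D}})<1\}$. An EC certificate for $D\subseteq S$ is a pair $(\mathtt{f},\mathtt{b})\in\mathbb{N}^D\times\mathbb{N}^D$ such that there is a unique $s^*\in D$ with $\mathtt{f}(s^*)=\mathtt{b}(s^*)=0$ and for every $s\in D\setminus\{s^*\}$: (1) there are $a\in Act(s)$ and $s'\in D$ with $\mathtt{f}(s)>\mathtt{f}(s')$, $\mathbf{P}(s,a,s')>0$ and $\mathbf{P}(s,a,D)=1$; (2) there are $s'\in D$ and $a'\in Act(s')$ with $\mathtt{b}(s)>\mathtt{b}(s')$, $\mathbf{P}(s',a',s)>0$ and $\mathbf{P}(s',a',D)=1$.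
   Formalization: The transition function $\mathbf{P}$ takes values in probability distributions with rational probabilities. -}

module Defs where

open import Data.Nat using (ℕ; zero; suc; _<_; _≤_; _⊓_; _+_)
open import Data.Fin using (Fin; zero; suc)
open import Data.Fin.Properties using () renaming (_≟_ to _≟ᶠ_)
open import Data.Rational using (ℚ; 0ℚ; 1ℚ) renaming (_+_ to _+ℚ_; _<_ to _<ℚ_; _≤_ to _≤ℚ_)
open import Data.Rational.Properties using () renaming (_<?_ to _<ℚ?_)
open import Data.Bool using (Bool; true; false; if_then_else_; _∨_)
open import Data.Maybe using (Maybe; just; nothing; maybe; Is-just)
open import Data.List using (List; []; _∷_; map; filter; allFin)
open import Data.Product using (_×_; ∃-syntax)
open import Data.Sum using (_⊎_)
open import Function using (_∘_)
open import Relation.Nullary using (¬_)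
open import Relation.Nullary.Decidable using (⌊_⌋)
open import Relation.Binary.PropositionalEquality using (_≡_; _≢_)

sumFin : ∀ {n} → (Fin n → ℚ) → ℚ
sumFin {zero}  f = 0ℚ
sumFin {suc n} f = f zero +ℚ sumFin (f ∘ suc)

anyFin : ∀ {n} → (Fin n → Bool) → Bool
anyFin {zero}  f = false
anyFin {suc n} f = f zero ∨ anyFin (f ∘ suc)

-- minimum of a list of naturals (only used on nonempty lists)
minList : List ℕ → ℕ
minList []           = 0
minList (x ∷ [])     = x
minList (x ∷ y ∷ ys) = x ⊓ minList (y ∷ ys)

record MDP : Set where
  field
    n       : ℕ
    m       : ℕ
    init    : Fin n
    P       : Fin n → Fin m → Maybe (Fin n → ℚ)
    P-nonneg : ∀ s a d → P s a ≡ just d → ∀ t → 0ℚ ≤ℚ d t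
    P-sum    : ∀ s a d → P s a ≡ just d → sumFin d ≡ 1ℚ

module MDPDefs (M : MDP) where
  open MDP M

  StateSet : Set
  StateSet = Fin n → Bool

  PairSet : Set
  PairSet = Fin n → Fin m → Bool

  -- (s,a) ∈ En, i.e. a ∈ Act(s)
  Enabled : Fin n → Fin m → Set
  Enabled s a = Is-just (P s a)

  -- P(s,a,t) (0 when P(s,a) is undefined; always used together with Enabled)
  Pr : Fin n → Fin m → Fin n → ℚ
  Pr s a t = maybe (λ d → d t) 0ℚ (P s a)

  PrSet : Fin n → Fin m → StateSet → ℚ
  PrSet s a T = sumFin (λ t → if T t then Pr s a t else 0ℚ)

  supp : Fin n → Fin m → List (Fin n)
  supp s a = filter (λ t → 0ℚ <ℚ? Pr s a t) (allFin n)

  statesOf : PairSet → StateSet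
  statesOf E s = anyFin (E s)

  _⊆ᴱ_ : PairSet → PairSet → Set
  E ⊆ᴱ E' = ∀ s a → E s a ≡ true → E' s a ≡ true

  data Reach (E : PairSet) : Fin n → Fin n → Set where
    here : ∀ {s} → Reach E s s
    step : ∀ {s s' t} (a : Fin m) → E s a ≡ true → statesOf E s ≡ true →
           statesOf E s' ≡ true → 0ℚ <ℚ Pr s a s' → Reach E s' t → Reach E s t

  IsEC : PairSet → Set
  IsEC E =
    (∃[ s ] ∃[ a ] E s a ≡ true) ×
    (∀ s a → E s a ≡ true → Enabled s a) ×
    (∀ s a → E s a ≡ true → PrSet s a (statesOf E) ≡ 1ℚ) ×
    (∀ s t → statesOf E s ≡ true → statesOf E t ≡ true → Reach E s t)

  IsMEC : PairSet → Set
  IsMEC E = IsEC E × (∀ E' → IsEC E' → E ⊆ᴱ E' → E' ⊆ᴱ E)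

  SameMECClass : Fin n → Fin n → Set
  SameMECClass s t = s ≡ t ⊎ (∃[ E ] IsMEC E × statesOf E s ≡ true × statesOf E t ≡ true)

  -- Partitions of S are given by a surjective labelling cls : Fin n → Fin k;
  -- the classes are the fibres.
  classOf : ∀ {k} → (Fin n → Fin k) → Fin k → StateSet
  classOf cls i s = ⌊ cls s ≟ᶠ i ⌋

  IsDMEC : ∀ {k} → (Fin n → Fin k) → Set
  IsDMEC cls = ∀ s t → (cls s ≡ cls t → SameMECClass s t) × (SameMECClass s t → cls s ≡ cls t)

  -- EC certificate (f , b) for D (values outside D are irrelevant)
  ECCert : StateSet → (Fin n → ℕ) → (Fin n → ℕ) → Set
  ECCert D f b =
    ∃[ s* ] (D s* ≡ true × f s* ≡ 0 × b s* ≡ 0 ×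
             (∀ s → D s ≡ true → f s ≡ 0 → b s ≡ 0 → s ≡ s*) ×
             (∀ s → D s ≡ true → s ≢ s* →
                (∃[ a ] ∃[ s' ] (Enabled s a × D s' ≡ true × f s' < f s ×
                                 0ℚ <ℚ Pr s a s' × PrSet s a D ≡ 1ℚ)) ×
                (∃[ s' ] ∃[ a' ] (D s' ≡ true × Enabled s' a' × b s' < b s ×
                                  0ℚ <ℚ Pr s' a' s × PrSet s' a' D ≡ 1ℚ))))

  EnD : ∀ {k} → (Fin n → Fin k) → Fin n → Fin m → Set
  EnD cls s a = Enabled s a × PrSet s a (classOf cls (cls s)) <ℚ 1ℚ

  MECCert : ∀ {k} → (Fin n → Fin k) → Set
  MECCert {k} cls =
    ((i : Fin k) → ∃[ f ] ∃[ b ] ECCert (classOf cls i) f b) ×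
    (∃[ r ] (∀ s a → EnD cls s a →
               1 + minList (map (r ∘ cls) (supp s a)) ≤ r (cls s)))

module Submission where

-- If D is ranked by r, every end component lies inside one class: a path of the EC leaving a
-- class does so through an action of En_D, whose successor of minimal rank lies in the EC and has
-- strictly smaller rank, so this can happen only finitely often.  The EC certificate of a class
-- makes its class-preserving actions strongly connected, so they form an EC, and even a MEC since
-- no EC crosses classes; hence D = D_MEC.
-- Conversely, if D = D_MEC, the EC certificate of a class consists of the distances to and from a
-- fixed state along the actions of its MEC, and the rank of a class is the first stage of an
-- attractor iteration at which every action leaving the class can reach a class of the previous
-- stage.  Were some class never reached, the actions leading only to such unranked classes would
-- contain a bottom strongly connected part: an end component containing a class-leaving action.

open import Defs
open import Data.Bool using (Bool; true; false; _∧_; if_then_else_)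
open import Data.Bool.Properties using (¬-not) renaming (_≟_ to _≟ᵇ_)
open import Data.Empty using (⊥; ⊥-elim)
open import Data.Fin using (Fin; zero; suc; remQuot)
open import Data.Fin.Properties using (any?; all?; ¬∀⟶∃¬; remQuot-combine) renaming (_≟_ to _≟ᶠ_)
open import Data.Fin.Subset using (Subset; _∈_; _⊂_; _⊃_)
open import Data.Fin.Subset.Induction using (Acc; acc; ⊂-wellFounded; ⊃-wellFounded)
open import Data.List using ([]; _∷_; map; allFin)
open import Data.List.Membership.Propositional as List using ()
open import Data.List.Membership.Propositional.Properties using (∈-map⁺; ∈-map⁻; ∈-filter⁺; ∈-filter⁻; ∈-allFin)
open import Data.List.Relation.Unary.Any using (here; there)
open import Data.Maybe using (just; nothing)
import Data.Maybe.Relation.Unary.Any as Maybe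
open import Data.Nat using (ℕ; zero; suc; _+_; _≤_; _<_; _*_; z≤n; s≤s)
import Data.Nat.Properties as ℕ
open import Data.Product using (_×_; _,_; ∃-syntax; proj₁; proj₂; uncurry)
open import Data.Rational using (ℚ; 0ℚ; 1ℚ) renaming (_≤_ to _≤ℚ_; _<_ to _<ℚ_; _+_ to _+ℚ_)
import Data.Rational.Properties as ℚ
open import Data.Sum using (_⊎_; inj₁; inj₂)
open import Data.Unit using (tt)
open import Data.Vec using (tabulate)
open import Data.Vec.Properties using (lookup∘tabulate; lookup⇒[]=; []=⇒lookup)
open import Function using (_∘_; flip)
open import Function.Definitions using (Surjective)
open import Level using (0ℓ)
open import Relation.Binary using (Rel) renaming (Decidable to Decidable₂)
open import Relation.Binary.Construct.Closure.ReflexiveTransitive using (Star; ε; _◅_; _◅◅_; reverse)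
import Relation.Binary.Construct.Closure.ReflexiveTransitive as Star
open import Relation.Binary.PropositionalEquality using (_≡_; _≢_; refl; sym; trans; cong; cong₂; subst)
open import Relation.Nullary using (¬_; Dec; yes; no; does; contradiction)
open import Relation.Nullary.Decidable using (¬?; _→-dec_; _×-dec_; _⊎-dec_; map′; decidable-stable; dec-true)
open import Relation.Unary using (Pred; Decidable; _⊆_)

does-true : ∀ {A : Set} (a? : Dec A) → does a? ≡ true → A
does-true (yes a) _ = a

counterexample : ∀ {N} {P Q : Pred (Fin N) 0ℓ} → Decidable P → Decidable Q →
                 ¬ (∀ x → P x → Q x) → ∃[ x ] (P x × ¬ Q x)
counterexample {N} P? Q? ¬∀ with ¬∀⟶∃¬ N _ (λ x → P? x →-dec Q? x) ¬∀
... | x , ¬P⇒Q with P? x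
...   | yes p = x , p , λ q → ¬P⇒Q (λ _ → q)
...   | no ¬p = contradiction (λ p → contradiction p ¬p) ¬P⇒Q

-- The least j < L with P j, or L if there is none.
μ : ∀ {P : Pred ℕ 0ℓ} → Decidable P → ℕ → ℕ
μ P? zero = zero
μ P? (suc L) with P? zero
... | yes _ = zero
... | no _ = suc (μ (P? ∘ suc) L)

μ-minimal : ∀ {P : Pred ℕ 0ℓ} (P? : Decidable P) L {j} → P j → μ P? L ≤ j
μ-minimal P? zero p = z≤n
μ-minimal P? (suc L) {j} p with P? zero | j
... | yes _ | _ = z≤n
... | no ¬p0 | zero = contradiction p ¬p0
... | no _ | suc j = s≤s (μ-minimal (P? ∘ suc) L p)

μ-witness : ∀ {P : Pred ℕ 0ℓ} (P? : Decidable P) L → P L → P (μ P? L)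
μ-witness P? zero p = p
μ-witness P? (suc L) p with P? zero
... | yes p0 = p0
... | no _ = μ-witness (P? ∘ suc) L p

minList-≤ : ∀ {xs y} → y List.∈ xs → minList xs ≤ y
minList-≤ {x ∷ []} (here refl) = ℕ.≤-refl
minList-≤ {x ∷ y ∷ ys} (here refl) = ℕ.m⊓n≤m x _
minList-≤ {x ∷ y ∷ ys} (there y∈) = ℕ.≤-trans (ℕ.m⊓n≤n x _) (minList-≤ y∈)

minList-∈ : ∀ x xs → minList (x ∷ xs) List.∈ x ∷ xs
minList-∈ x [] = here refl
minList-∈ x (y ∷ ys) with ℕ.⊓-sel x (minList (y ∷ ys))
... | inj₁ eq = here eq
... | inj₂ eq rewrite eq = there (minList-∈ y ys)

minList-attained : ∀ {A : Set} (g : A → ℕ) {xs y} → y List.∈ xs → ∃[ x ] (x List.∈ xs × minList (map g xs) ≡ g x)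
minList-attained g {x ∷ xs} _ with ∈-map⁻ g (minList-∈ (g x) (map g xs))
... | y , y∈ , eq = y , y∈ , eq

Star-exit : ∀ {N} {R : Rel (Fin N) 0ℓ} {P : Pred (Fin N) 0ℓ} → Decidable P →
            ∀ {x y} → Star R x y → P x → ¬ P y → ∃[ u ] ∃[ v ] (P u × ¬ P v × R u v)
Star-exit P? ε px ¬py = contradiction px ¬py
Star-exit P? (_◅_ {j = v} r rs) px ¬py with P? v
... | yes pv = Star-exit P? rs pv ¬py
... | no ¬pv = _ , v , px , ¬pv , r

Star-first : ∀ {N} {R : Rel (Fin N) 0ℓ} {x y} → Star R x y → x ≢ y → ∃[ z ] R x z
Star-first ε x≢y = contradiction refl x≢y
Star-first (r ◅ _) _ = _ , r

descent⇒Star : ∀ {N} {R : Rel (Fin N) 0ℓ} {P : Pred (Fin N) 0ℓ} {t} (d : Fin N → ℕ) →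
  (∀ {s} → P s → s ≢ t → ∃[ s' ] (P s' × R s s' × d s' < d s)) → ∀ {s} → P s → Star R s t
descent⇒Star {R = R} {P} {t} d desc {s} ps = go (suc (d s)) ℕ.≤-refl ps
  where
  go : ∀ fuel {s} → d s < fuel → P s → Star R s t
  go (suc fuel) {s} lt ps with s ≟ᶠ t
  ... | yes refl = ε
  ... | no s≢t with desc ps s≢t
  ...   | s' , ps' , r , lt' = r ◅ go fuel (ℕ.≤-trans lt' (ℕ.≤-pred lt)) ps'

module _ {N : ℕ} where

  ⟦_⟧ : {P : Pred (Fin N) 0ℓ} → Decidable P → Subset N
  ⟦ P? ⟧ = tabulate (does ∘ P?)

  ∈⟦⟧⁺ : ∀ {P : Pred (Fin N) 0ℓ} (P? : Decidable P) {x} → P x → x ∈ ⟦ P? ⟧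
  ∈⟦⟧⁺ P? {x} p = lookup⇒[]= x _ (trans (lookup∘tabulate _ x) (dec-true (P? x) p))

  ∈⟦⟧⁻ : ∀ {P : Pred (Fin N) 0ℓ} (P? : Decidable P) {x} → x ∈ ⟦ P? ⟧ → P x
  ∈⟦⟧⁻ P? {x} x∈ = does-true (P? x) (trans (sym (lookup∘tabulate _ x)) ([]=⇒lookup x∈))

  ⟦⟧-⊂ : ∀ {P Q : Pred (Fin N) 0ℓ} (P? : Decidable P) (Q? : Decidable Q) →
         P ⊆ Q → ∀ {x} → Q x → ¬ P x → ⟦ P? ⟧ ⊂ ⟦ Q? ⟧
  ⟦⟧-⊂ P? Q? P⊆Q {x} qx ¬px =
    (λ y∈ → ∈⟦⟧⁺ Q? (P⊆Q (∈⟦⟧⁻ P? y∈))) , x , ∈⟦⟧⁺ Q? qx , λ x∈ → ¬px (∈⟦⟧⁻ P? x∈)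

  ascending-chain-stabilises : (X : ℕ → Pred (Fin N) 0ℓ) → (∀ j → Decidable (X j)) →
                               (∀ j → X j ⊆ X (suc j)) → ∃[ j ] X (suc j) ⊆ X j
  ascending-chain-stabilises X X? X-step = go 0 (⊃-wellFounded _)
    where
    go : ∀ j → Acc _⊃_ ⟦ X? j ⟧ → ∃[ j ] X (suc j) ⊆ X j
    go j (acc rs) with all? (λ x → X? (suc j) x →-dec X? j x)
    ... | yes stable = j , stable _
    ... | no ¬stable with counterexample (X? (suc j)) (X? j) ¬stable
    ...   | x , new , ¬old = go (suc j) (rs (⟦⟧-⊂ (X? j) (X? (suc j)) (X-step j) new ¬old))

module Reachability {N} {R : Rel (Fin N) 0ℓ} (R? : Decidable₂ R) (x₀ : Fin N) where

  Within : ℕ → Pred (Fin N) 0ℓ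
  Within zero y = x₀ ≡ y
  Within (suc j) y = Within j y ⊎ ∃[ y' ] (Within j y' × R y' y)

  Within? : ∀ j → Decidable (Within j)
  Within? zero y = x₀ ≟ᶠ y
  Within? (suc j) y = Within? j y ⊎-dec any? (λ y' → Within? j y' ×-dec R? y' y)

  Within⇒Star : ∀ {j y} → Within j y → Star R x₀ y
  Within⇒Star {zero} refl = ε
  Within⇒Star {suc j} (inj₁ w) = Within⇒Star w
  Within⇒Star {suc j} (inj₂ (y' , w , r)) = Within⇒Star w ◅◅ r ◅ ε

  stabilisation : ∃[ x ] Within (suc x) ⊆ Within x
  stabilisation = ascending-chain-stabilises Within Within? (λ _ → inj₁)

  horizon : ℕ
  horizon = proj₁ stabilisation

  Within-source : ∀ j → Within j x₀
  Within-source zero = refl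
  Within-source (suc j) = inj₁ (Within-source j)

  Star⇒Within : ∀ {y} → Star R x₀ y → Within horizon y
  Star⇒Within = go (Within-source horizon)
    where
    closed : ∀ {u v} → Within horizon u → R u v → Within horizon v
    closed w r = proj₂ stabilisation (inj₂ (_ , w , r))
    go : ∀ {u v} → Within horizon u → Star R u v → Within horizon v
    go w ε = w
    go w (r ◅ rs) = go (closed w r) rs

  Star? : Decidable (Star R x₀)
  Star? y = map′ Within⇒Star Star⇒Within (Within? horizon y)

  -- The distance from x₀; a junk value for unreachable states.
  dist : Fin N → ℕ
  dist y = μ (λ j → Within? j y) horizon

  dist-minimal : ∀ {j y} → Within j y → dist y ≤ j
  dist-minimal {y = y} = μ-minimal (λ j → Within? j y) horizon

  dist-attained : ∀ {y} → Star R x₀ y → Within (dist y) y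
  dist-attained {y} p = μ-witness (λ j → Within? j y) horizon (Star⇒Within p)

  dist-source : dist x₀ ≡ 0
  dist-source = ℕ.n≤0⇒n≡0 (dist-minimal {0} refl)

  dist-zero : ∀ {y} → Star R x₀ y → dist y ≡ 0 → y ≡ x₀
  dist-zero {y} p eq = sym (subst (λ j → Within j y) eq (dist-attained p))

  dist-descent : ∀ {y} → Star R x₀ y → y ≢ x₀ → ∃[ y' ] (R y' y × dist y' < dist y)
  dist-descent {y} p y≢x₀ = go (dist y) (dist-attained p) dist-minimal
    where
    go : ∀ d → Within d y → (∀ {j} → Within j y → d ≤ j) → ∃[ y' ] (R y' y × dist y' < d)
    go zero w _ = contradiction (sym w) y≢x₀
    go (suc j) (inj₁ w) least = contradiction (least w) ℕ.1+n≰n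
    go (suc j) (inj₂ (y' , w , r)) _ = y' , r , s≤s (dist-minimal w)

sumFin-cong : ∀ {N} {f g : Fin N → ℚ} → (∀ i → f i ≡ g i) → sumFin f ≡ sumFin g
sumFin-cong {zero} eq = refl
sumFin-cong {suc N} eq = cong₂ _+ℚ_ (eq zero) (sumFin-cong (eq ∘ suc))

sumFin-zero : ∀ N → sumFin {N} (λ _ → 0ℚ) ≡ 0ℚ
sumFin-zero zero = refl
sumFin-zero (suc N) = trans (ℚ.+-identityˡ _) (sumFin-zero N)

sumFin-mono-≤ : ∀ {N} {f g : Fin N → ℚ} → (∀ i → f i ≤ℚ g i) → sumFin f ≤ℚ sumFin g
sumFin-mono-≤ {zero} le = ℚ.≤-refl
sumFin-mono-≤ {suc N} le = ℚ.+-mono-≤ (le zero) (sumFin-mono-≤ (le ∘ suc))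

sumFin-mono-< : ∀ {N} {f g : Fin N → ℚ} → (∀ i → f i ≤ℚ g i) → ∀ j → f j <ℚ g j → sumFin f <ℚ sumFin g
sumFin-mono-< le zero lt = ℚ.+-mono-<-≤ lt (sumFin-mono-≤ (le ∘ suc))
sumFin-mono-< le (suc j) lt = ℚ.+-mono-≤-< (le zero) (sumFin-mono-< (le ∘ suc) j lt)

anyFin-true⁺ : ∀ {N} (f : Fin N → Bool) i → f i ≡ true → anyFin f ≡ true
anyFin-true⁺ f zero eq rewrite eq = refl
anyFin-true⁺ f (suc i) eq with f zero
... | true = refl
... | false = anyFin-true⁺ (f ∘ suc) i eq

anyFin-true⁻ : ∀ {N} (f : Fin N → Bool) → anyFin f ≡ true → ∃[ i ] f i ≡ true
anyFin-true⁻ {suc N} f eq with f zero in f0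
... | true = zero , f0
... | false with anyFin-true⁻ (f ∘ suc) eq
...   | i , fi = suc i , fi

module MDPTheory (M : MDP) where
  open MDP M
  open MDPDefs M

  Enabled? : ∀ s a → Dec (Enabled s a)
  Enabled? s a = Maybe.dec (λ _ → yes tt) (P s a)

  Pr-nonneg : ∀ s a t → 0ℚ ≤ℚ Pr s a t
  Pr-nonneg s a t with P s a in eq
  ... | just d = P-nonneg s a d eq t
  ... | nothing = ℚ.≤-refl

  Pr-sum : ∀ {s a} → Enabled s a → sumFin (Pr s a) ≡ 1ℚ
  Pr-sum {s} {a} en with P s a in eq
  Pr-sum (Maybe.just tt) | just d = P-sum _ _ d eq

  Pr-disabled : ∀ {s a} → ¬ Enabled s a → ∀ t → Pr s a t ≡ 0ℚ
  Pr-disabled {s} {a} ¬en t with P s a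
  ... | just d = contradiction (Maybe.just tt) ¬en
  ... | nothing = refl

  Pr-pos? : ∀ s a t → Dec (0ℚ <ℚ Pr s a t)
  Pr-pos? s a t = 0ℚ ℚ.<? Pr s a t

  ∈supp⁺ : ∀ {s a t} → 0ℚ <ℚ Pr s a t → t List.∈ supp s a
  ∈supp⁺ {s} {a} {t} = ∈-filter⁺ (Pr-pos? s a) (∈-allFin t)

  ∈supp⁻ : ∀ {s a t} → t List.∈ supp s a → 0ℚ <ℚ Pr s a t
  ∈supp⁻ {s} {a} = proj₂ ∘ ∈-filter⁻ (Pr-pos? s a) {xs = allFin n}

  summand≤Pr : ∀ s a (T : StateSet) t → (if T t then Pr s a t else 0ℚ) ≤ℚ Pr s a t
  summand≤Pr s a T t with T t
  ... | true = ℚ.≤-refl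
  ... | false = Pr-nonneg s a t

  PrSet≤1 : ∀ {s a} T → Enabled s a → PrSet s a T ≤ℚ 1ℚ
  PrSet≤1 {s} {a} T en = subst (PrSet s a T ≤ℚ_) (Pr-sum en) (sumFin-mono-≤ (summand≤Pr s a T))

  PrSet≡1⇒Enabled : ∀ {s a T} → PrSet s a T ≡ 1ℚ → Enabled s a
  PrSet≡1⇒Enabled {s} {a} {T} eq with Enabled? s a
  ... | yes en = en
  ... | no ¬en = contradiction (trans (sym eq) (trans (sumFin-cong vanish) (sumFin-zero n))) λ ()
    where
    vanish : ∀ t → (if T t then Pr s a t else 0ℚ) ≡ 0ℚ
    vanish t with T t
    ... | true = Pr-disabled ¬en t
    ... | false = refl

  PrSet≡1⇒supp⊆ : ∀ {s a T t} → PrSet s a T ≡ 1ℚ → 0ℚ <ℚ Pr s a t → T t ≡ true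
  PrSet≡1⇒supp⊆ {s} {a} {T} {t} eq pos with T t in Tt
  ... | true = refl
  ... | false = contradiction (trans eq (sym (Pr-sum (PrSet≡1⇒Enabled eq)))) (ℚ.<⇒≢ PrSet<sum)
    where
    PrSet<sum : PrSet s a T <ℚ sumFin (Pr s a)
    PrSet<sum = sumFin-mono-< (summand≤Pr s a T) t (subst (λ b → (if b then _ else 0ℚ) <ℚ _) (sym Tt) pos)

  supp⊆⇒PrSet≡1 : ∀ {s a T} → Enabled s a → (∀ t → 0ℚ <ℚ Pr s a t → T t ≡ true) → PrSet s a T ≡ 1ℚ
  supp⊆⇒PrSet≡1 {s} {a} {T} en supp⊆ = trans (sumFin-cong summand≡Pr) (Pr-sum en)
    where
    summand≡Pr : ∀ t → (if T t then Pr s a t else 0ℚ) ≡ Pr s a t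
    summand≡Pr t with T t in Tt | Pr-pos? s a t
    ... | true | _ = refl
    ... | false | yes pos = contradiction (trans (sym Tt) (supp⊆ t pos)) λ ()
    ... | false | no ¬pos = ℚ.≤-antisym (Pr-nonneg s a t) (ℚ.≮⇒≥ ¬pos)

  PrSet≢1⇒leaves : ∀ {s a T} → Enabled s a → PrSet s a T ≢ 1ℚ → ∃[ t ] (0ℚ <ℚ Pr s a t × T t ≡ false)
  PrSet≢1⇒leaves {s} {a} {T} en ≢1 with counterexample (Pr-pos? s a) (λ t → T t ≟ᵇ true) (≢1 ∘ supp⊆⇒PrSet≡1 en)
  ... | t , pos , ¬in = t , pos , ¬-not ¬in

  PrSet≢1⇒<1 : ∀ {s a T} → Enabled s a → PrSet s a T ≢ 1ℚ → PrSet s a T <ℚ 1ℚ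
  PrSet≢1⇒<1 {s} {a} {T} en ≢1 with PrSet s a T ℚ.<? 1ℚ
  ... | yes lt = lt
  ... | no ≮1 = contradiction (ℚ.≤-antisym (PrSet≤1 T en) (ℚ.≮⇒≥ ≮1)) ≢1

  _∈S_ : Fin n → PairSet → Set
  s ∈S E = statesOf E s ≡ true

  ∈S⁺ : ∀ E {s a} → E s a ≡ true → s ∈S E
  ∈S⁺ E {s} = anyFin-true⁺ (E s) _

  ∈S⁻ : ∀ E {s} → s ∈S E → ∃[ a ] E s a ≡ true
  ∈S⁻ E {s} = anyFin-true⁻ (E s)

  ⊆ᴱ-states : ∀ {E E' s} → E ⊆ᴱ E' → s ∈S E → s ∈S E'
  ⊆ᴱ-states {E} {E'} {s} E⊆E' s∈ = ∈S⁺ E' (E⊆E' s _ (proj₂ (∈S⁻ E s∈)))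

  Edge : PairSet → Rel (Fin n) 0ℓ
  Edge E s t = ∃[ a ] (E s a ≡ true × 0ℚ <ℚ Pr s a t)

  Edge? : ∀ E → Decidable₂ (Edge E)
  Edge? E s t = any? λ a → (E s a ≟ᵇ true) ×-dec Pr-pos? s a t

  Edge-mono : ∀ {E E'} → E ⊆ᴱ E' → ∀ {s t} → Edge E s t → Edge E' s t
  Edge-mono E⊆E' (a , e , pos) = a , E⊆E' _ a e , pos

  Edge-source : ∀ E {s t} → Edge E s t → s ∈S E
  Edge-source E (_ , e , _) = ∈S⁺ E e

  Reach⇒Star : ∀ {E s t} → Reach E s t → Star (Edge E) s t
  Reach⇒Star here = ε
  Reach⇒Star (step a e _ _ pos r) = (a , e , pos) ◅ Reach⇒Star r

  SuccClosed : PairSet → Set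
  SuccClosed E = ∀ {s a t} → E s a ≡ true → 0ℚ <ℚ Pr s a t → t ∈S E

  Star⇒Reach : ∀ {E} → SuccClosed E → ∀ {s t} → Star (Edge E) s t → Reach E s t
  Star⇒Reach closed ε = here
  Star⇒Reach {E} closed ((a , e , pos) ◅ r) = step a e (∈S⁺ E e) (closed e pos) pos (Star⇒Reach closed r)

  mkEC : ∀ {E} → (∃[ s ] ∃[ a ] E s a ≡ true) → (∀ {s a} → E s a ≡ true → Enabled s a) → SuccClosed E →
         (∀ {s t} → s ∈S E → t ∈S E → Star (Edge E) s t) → IsEC E
  mkEC nonempty enabled closed connected =
    nonempty , (λ _ _ → enabled) , (λ _ _ e → supp⊆⇒PrSet≡1 (enabled e) (λ _ → closed e)) ,
    (λ _ _ s∈ t∈ → Star⇒Reach closed (connected s∈ t∈))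

  EC-enabled : ∀ {E s a} → IsEC E → E s a ≡ true → Enabled s a
  EC-enabled (_ , enabled , _) = enabled _ _

  EC-succ : ∀ {E} → IsEC E → SuccClosed E
  EC-succ (_ , _ , closed , _) e = PrSet≡1⇒supp⊆ (closed _ _ e)

  EC-connected : ∀ {E s t} → IsEC E → s ∈S E → t ∈S E → Star (Edge E) s t
  EC-connected (_ , _ , _ , connected) s∈ t∈ = Reach⇒Star (connected _ _ s∈ t∈)

  -- A pair set as a subset of Fin (n * m), so that ⊃ is well-founded on pair sets.
  Pairs : PairSet → Pred (Fin (n * m)) 0ℓ
  Pairs E p = uncurry E (remQuot m p) ≡ true

  Pairs? : ∀ E → Decidable (Pairs E)
  Pairs? E p = uncurry E (remQuot m p) ≟ᵇ true

  -- Only ¬ ¬ since IsEC is undecidable; all conclusions drawn from it are decidable.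
  EC⊆MEC : ∀ {E} → IsEC E → ¬ ¬ (∃[ E' ] (IsMEC E' × E ⊆ᴱ E'))
  EC⊆MEC {E} = go E (⊃-wellFounded _)
    where
    go : ∀ E → Acc _⊃_ ⟦ Pairs? E ⟧ → IsEC E → ¬ ¬ (∃[ E' ] (IsMEC E' × E ⊆ᴱ E'))
    go E (acc rs) ec ¬above = ¬above (E , (ec , maximal) , λ _ _ e → e)
      where
      maximal : ∀ E' → IsEC E' → E ⊆ᴱ E' → E' ⊆ᴱ E
      maximal E' ec' E⊆E' s a e' with E s a in e
      ... | true = refl
      ... | false = ⊥-elim (go E' (rs larger) ec' λ (E'' , mec , E'⊆E'') →
                      ¬above (E'' , mec , λ s a → E'⊆E'' s a ∘ E⊆E' s a))
        where
        larger : ⟦ Pairs? E ⟧ ⊂ ⟦ Pairs? E' ⟧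
        larger = ⟦⟧-⊂ (Pairs? E) (Pairs? E') (λ {p} → E⊆E' (proj₁ (remQuot {n} m p)) (proj₂ (remQuot {n} m p)))
                   (subst (λ q → uncurry E' q ≡ true) (sym (remQuot-combine s a)) e')
                   (λ e'' → contradiction (trans (sym e) (subst (λ q → uncurry E q ≡ true) (remQuot-combine s a) e'')) λ ())

  StayIn : StateSet → PairSet
  StayIn D s a = D s ∧ does (PrSet s a D ℚ.≟ 1ℚ)

  StayIn⁺ : ∀ {D s a} → D s ≡ true → PrSet s a D ≡ 1ℚ → StayIn D s a ≡ true
  StayIn⁺ {D} {s} {a} Ds eq rewrite Ds = dec-true (PrSet s a D ℚ.≟ 1ℚ) eq

  StayIn⁻ : ∀ D {s a} → StayIn D s a ≡ true → D s ≡ true × PrSet s a D ≡ 1ℚ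
  StayIn⁻ D {s} {a} e with D s
  ... | true = refl , does-true (PrSet s a D ℚ.≟ 1ℚ) e

  StayIn-source : ∀ {D s t} → Edge (StayIn D) s t → D s ≡ true
  StayIn-source (_ , e , _) = proj₁ (StayIn⁻ _ e)

  StayIn-target : ∀ {D s t} → Edge (StayIn D) s t → D t ≡ true
  StayIn-target (_ , e , pos) = PrSet≡1⇒supp⊆ (proj₂ (StayIn⁻ _ e)) pos

  StayIn-maximal : ∀ {D E} → IsEC E → (∀ {s} → s ∈S E → D s ≡ true) → E ⊆ᴱ StayIn D
  StayIn-maximal {E = E} ec inD s a e = StayIn⁺ (inD (∈S⁺ E e)) (supp⊆⇒PrSet≡1 (EC-enabled ec e) (λ _ → inD ∘ EC-succ ec e))

  Descends : StateSet → Rel (Fin n) 0ℓ → (Fin n → ℕ) → Fin n → Set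
  Descends D R d s* = ∀ {s} → D s ≡ true → s ≢ s* → ∃[ s' ] (D s' ≡ true × R s s' × d s' < d s)

  ECCert⇒descents : ∀ {D f b} → ECCert D f b →
    ∃[ s* ] (D s* ≡ true × Descends D (Edge (StayIn D)) f s* × Descends D (flip (Edge (StayIn D))) b s*)
  ECCert⇒descents {D} {f} {b} (s* , Ds* , _ , _ , _ , desc) = s* , Ds* , forward , backward
    where
    forward : Descends D (Edge (StayIn D)) f s*
    forward Ds s≢s* = let a , s' , _ , Ds' , lt , pos , stays = proj₁ (desc _ Ds s≢s*)
                      in s' , Ds' , (a , StayIn⁺ Ds stays , pos) , lt
    backward : Descends D (flip (Edge (StayIn D))) b s*
    backward Ds s≢s* = let s' , a , Ds' , _ , lt , pos , stays = proj₂ (desc _ Ds s≢s*)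
                       in s' , Ds' , (a , StayIn⁺ Ds' stays , pos) , lt

  descents⇒ECCert : ∀ {D f b s*} → D s* ≡ true → f s* ≡ 0 → b s* ≡ 0 → (∀ {s} → D s ≡ true → f s ≡ 0 → s ≡ s*) →
    Descends D (Edge (StayIn D)) f s* → Descends D (flip (Edge (StayIn D))) b s* → ECCert D f b
  descents⇒ECCert {D} {f} {b} {s*} Ds* f0 b0 unique forward backward =
    s* , Ds* , f0 , b0 , (λ _ Ds fs≡0 _ → unique Ds fs≡0) , λ _ Ds s≢s* → out (forward Ds s≢s*) , into (backward Ds s≢s*)
    where
    out : ∀ {s} → ∃[ s' ] (D s' ≡ true × Edge (StayIn D) s s' × f s' < f s) →
          ∃[ a ] ∃[ s' ] (Enabled s a × D s' ≡ true × f s' < f s × 0ℚ <ℚ Pr s a s' × PrSet s a D ≡ 1ℚ)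
    out (s' , Ds' , (a , e , pos) , lt) = a , s' , PrSet≡1⇒Enabled (proj₂ (StayIn⁻ _ e)) , Ds' , lt , pos , proj₂ (StayIn⁻ _ e)
    into : ∀ {s} → ∃[ s' ] (D s' ≡ true × Edge (StayIn D) s' s × b s' < b s) →
           ∃[ s' ] ∃[ a ] (D s' ≡ true × Enabled s' a × b s' < b s × 0ℚ <ℚ Pr s' a s × PrSet s' a D ≡ 1ℚ)
    into (s' , Ds' , (a , e , pos) , lt) = s' , a , Ds' , PrSet≡1⇒Enabled (proj₂ (StayIn⁻ _ e)) , lt , pos , proj₂ (StayIn⁻ _ e)

  certified-connected : ∀ {D f b} → ECCert D f b → ∀ {s t} → D s ≡ true → D t ≡ true → Star (Edge (StayIn D)) s t
  certified-connected {f = f} {b} cert Ds Dt =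
    let _ , _ , forward , backward = ECCert⇒descents cert
    in descent⇒Star f forward Ds ◅◅ reverse (λ e → e) (descent⇒Star b backward Dt)

  module _ {D f b} (cert : ECCert D f b) {s t} (Ds : D s ≡ true) (Dt : D t ≡ true) (s≢t : s ≢ t) where

    certified-states : ∀ {u} → D u ≡ true → u ∈S StayIn D
    certified-states {u} Du with u ≟ᶠ s
    ... | yes refl = Edge-source (StayIn D) (proj₂ (Star-first (certified-connected cert Du Dt) s≢t))
    ... | no u≢s = Edge-source (StayIn D) (proj₂ (Star-first (certified-connected cert Du Ds) u≢s))

    certified-EC : IsEC (StayIn D)
    certified-EC = mkEC (s , ∈S⁻ (StayIn D) (certified-states Ds)) (PrSet≡1⇒Enabled ∘ proj₂ ∘ StayIn⁻ D)
      (λ e pos → certified-states (PrSet≡1⇒supp⊆ (proj₂ (StayIn⁻ _ e)) pos))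
      (λ s∈ t∈ → certified-connected cert (inD s∈) (inD t∈))
      where
      inD : ∀ {u} → u ∈S StayIn D → D u ≡ true
      inD u∈ = proj₁ (StayIn⁻ D (proj₂ (∈S⁻ (StayIn D) u∈)))

  module Classes {k} (cls : Fin n → Fin k) where

    classOf⁺ : ∀ {i s} → cls s ≡ i → classOf cls i s ≡ true
    classOf⁺ {i} {s} eq with cls s ≟ᶠ i
    ... | yes _ = refl
    ... | no ≢ = contradiction eq ≢

    classOf⁻ : ∀ {i s} → classOf cls i s ≡ true → cls s ≡ i
    classOf⁻ {i} {s} with cls s ≟ᶠ i
    ... | yes eq = λ _ → eq

    ECsInsideClasses : Set
    ECsInsideClasses = ∀ {E} → IsEC E → ∀ {s t} → s ∈S E → t ∈S E → cls s ≡ cls t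

    Ranking : (Fin k → ℕ) → Set
    Ranking r = ∀ s a → EnD cls s a → 1 + minList (map (r ∘ cls) (supp s a)) ≤ r (cls s)

    leaves⇒EnD : ∀ {s a t} → Enabled s a → 0ℚ <ℚ Pr s a t → cls t ≢ cls s → EnD cls s a
    leaves⇒EnD {s} {a} en pos t∉ = en , PrSet≢1⇒<1 {s} {a} {classOf cls (cls s)} en (λ eq → t∉ (classOf⁻ (PrSet≡1⇒supp⊆ eq pos)))

    EnD⇒leaves : ∀ {s a} → EnD cls s a → ∃[ t ] (0ℚ <ℚ Pr s a t × cls t ≢ cls s)
    EnD⇒leaves {s} {a} (en , <1) =
      let t , pos , t∉ = PrSet≢1⇒leaves {s} {a} {classOf cls (cls s)} en (ℚ.<⇒≢ <1)
      in t , pos , λ eq → contradiction (trans (sym t∉) (classOf⁺ eq)) λ ()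

    rank-descent : ∀ {r} → Ranking r → ∀ {s a} → EnD cls s a → ∃[ t ] (0ℚ <ℚ Pr s a t × r (cls t) < r (cls s))
    rank-descent {r} ranked {s} {a} leaving =
      let t , t∈ , min≡ = minList-attained (r ∘ cls) (∈supp⁺ {s} {a} (proj₁ (proj₂ (EnD⇒leaves leaving))))
      in t , ∈supp⁻ t∈ , subst (λ x → suc x ≤ r (cls s)) min≡ (ranked s a leaving)

    ranked⇒ECsInsideClasses : ∀ {r} → Ranking r → ECsInsideClasses
    ranked⇒ECsInsideClasses {r} ranked {E} ec {s} s∈ t∈ = sym (go (suc (r (cls s))) ℕ.≤-refl s∈ t∈)
      where
      go : ∀ fuel {w} → r (cls w) < fuel → w ∈S E → ∀ {w'} → w' ∈S E → cls w' ≡ cls w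
      go (suc fuel) {w} lt w∈ {w'} w'∈ = decidable-stable (cls w' ≟ᶠ cls w) λ w'≁w →
        let x , y , x∼w , y≁w , (a , e , pos) = Star-exit (λ u → cls u ≟ᶠ cls w) (EC-connected ec w∈ w'∈) refl w'≁w
            z , pos' , z<x = rank-descent {r} ranked (leaves⇒EnD (EC-enabled ec e) pos (λ eq → y≁w (trans eq x∼w)))
            z<fuel = ℕ.<-≤-trans z<x (subst (λ i → r i ≤ fuel) (sym x∼w) (ℕ.≤-pred lt))
        in ℕ.<⇒≢ z<x (sym (cong r (go fuel z<fuel (EC-succ ec e pos') (∈S⁺ E e))))

    StayIn-MEC : ECsInsideClasses → ∀ {i} → IsEC (StayIn (classOf cls i)) → IsMEC (StayIn (classOf cls i))
    StayIn-MEC inside {i} ec@((w , a , e) , _) = ec , maximal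
      where
      maximal : ∀ E' → IsEC E' → StayIn (classOf cls i) ⊆ᴱ E' → E' ⊆ᴱ StayIn (classOf cls i)
      maximal E' ec' sub = StayIn-maximal ec' λ u∈ →
        classOf⁺ (trans (inside ec' u∈ (∈S⁺ E' (sub w a e))) (classOf⁻ (proj₁ (StayIn⁻ _ e))))

    certified-MEC : ECsInsideClasses → ∀ {i f b} → ECCert (classOf cls i) f b →
                    ∀ {s t} → cls s ≡ i → cls t ≡ i → s ≢ t → ∃[ E ] (IsMEC E × s ∈S E × t ∈S E)
    certified-MEC inside {i} cert {s} {t} s∼i t∼i s≢t =
      StayIn (classOf cls i) , StayIn-MEC inside (certified-EC cert Ds Dt s≢t) ,
      certified-states cert Ds Dt s≢t Ds , certified-states cert Ds Dt s≢t Dt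
      where
      Ds : classOf cls i s ≡ true
      Ds = classOf⁺ s∼i
      Dt : classOf cls i t ≡ true
      Dt = classOf⁺ t∼i

    certificate⇒DMEC : MECCert cls → IsDMEC cls
    certificate⇒DMEC (certs , r , ranked) s t = sameClass⇒sameMEC , sameMEC⇒sameClass
      where
      inside : ECsInsideClasses
      inside = ranked⇒ECsInsideClasses {r} ranked
      sameMEC⇒sameClass : SameMECClass s t → cls s ≡ cls t
      sameMEC⇒sameClass (inj₁ refl) = refl
      sameMEC⇒sameClass (inj₂ (E , (ec , _) , s∈ , t∈)) = inside ec s∈ t∈
      sameClass⇒sameMEC : cls s ≡ cls t → SameMECClass s t
      sameClass⇒sameMEC eq with s ≟ᶠ t
      ... | yes s≡t = inj₁ s≡t
      ... | no s≢t = inj₂ (certified-MEC inside (proj₂ (proj₂ (certs (cls s)))) refl (sym eq) s≢t)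

    DMEC⇒ECsInsideClasses : IsDMEC cls → ECsInsideClasses
    DMEC⇒ECsInsideClasses dm ec {s} {t} s∈ t∈ = decidable-stable (cls s ≟ᶠ cls t) λ ≢ →
      EC⊆MEC ec λ { (E' , mec , sub) → ≢ (proj₂ (dm s t) (inj₂ (E' , mec , ⊆ᴱ-states sub s∈ , ⊆ᴱ-states sub t∈))) }

    class-connected : IsDMEC cls → ∀ {i s t} → cls s ≡ i → cls t ≡ i → Star (Edge (StayIn (classOf cls i))) s t
    class-connected dm {i} {s} {t} s∼i t∼i with proj₁ (dm s t) (trans s∼i (sym t∼i))
    ... | inj₁ refl = ε
    ... | inj₂ (E , (ec , _) , s∈ , t∈) = Star.map (Edge-mono (StayIn-maximal ec inD)) (EC-connected ec s∈ t∈)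
      where
      inD : ∀ {u} → u ∈S E → classOf cls i u ≡ true
      inD u∈ = classOf⁺ (trans (DMEC⇒ECsInsideClasses dm ec u∈ s∈) s∼i)

    class-certificate : IsDMEC cls → ∀ {i s*} → cls s* ≡ i → ∃[ f ] ∃[ b ] ECCert (classOf cls i) f b
    class-certificate dm {i} {s*} s*∼i =
      To.dist , From.dist ,
      descents⇒ECCert (classOf⁺ s*∼i) To.dist-source From.dist-source (To.dist-zero ∘ to-s*) forward backward
      where
      D : StateSet
      D = classOf cls i
      module To = Reachability {R = flip (Edge (StayIn D))} (flip (Edge? (StayIn D))) s*
      module From = Reachability (Edge? (StayIn D)) s*
      to-s* : ∀ {u} → D u ≡ true → Star (flip (Edge (StayIn D))) s* u
      to-s* Du = reverse (λ e → e) (class-connected dm (classOf⁻ Du) s*∼i)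
      from-s* : ∀ {u} → D u ≡ true → Star (Edge (StayIn D)) s* u
      from-s* Du = class-connected dm s*∼i (classOf⁻ Du)
      forward : Descends D (Edge (StayIn D)) To.dist s*
      forward Ds s≢s* = let s' , e , lt = To.dist-descent (to-s* Ds) s≢s* in s' , StayIn-target e , e , lt
      backward : Descends D (flip (Edge (StayIn D))) From.dist s*
      backward Ds s≢s* = let s' , e , lt = From.dist-descent (from-s* Ds) s≢s* in s' , StayIn-source e , e , lt

    module RankingConstruction (dm : IsDMEC cls) where

      inside : ECsInsideClasses
      inside = DMEC⇒ECsInsideClasses dm

      EnD? : ∀ s a → Dec (EnD cls s a)
      EnD? s a = Enabled? s a ×-dec (PrSet s a (classOf cls (cls s)) ℚ.<? 1ℚ)

      -- Good j i: class i can be given rank at most j.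
      Good : ℕ → Pred (Fin k) 0ℓ
      Escapes : ℕ → Fin n → Fin m → Set
      Good zero i = ⊥
      Good (suc j) i = ∀ s → cls s ≡ i → ∀ a → EnD cls s a → Escapes j s a
      Escapes j s a = ∃[ t ] (0ℚ <ℚ Pr s a t × Good j (cls t))

      Good? : ∀ j → Decidable (Good j)
      Escapes? : ∀ j s a → Dec (Escapes j s a)
      Good? zero i = no λ ()
      Good? (suc j) i = all? λ s → (cls s ≟ᶠ i) →-dec all? λ a → EnD? s a →-dec Escapes? j s a
      Escapes? j s a = any? λ t → Pr-pos? s a t ×-dec Good? j (cls t)

      Good-step : ∀ j → Good j ⊆ Good (suc j)
      Good-step (suc j) good s s∼i a leaving =
        let t , pos , good' = good s s∼i a leaving in t , pos , Good-step j good'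

      module Stabilised (x : ℕ) (stable : Good (suc x) ⊆ Good x) where

        Unranked : Pred (Fin n) 0ℓ
        Unranked s = ¬ Good x (cls s)

        Trapped : Fin n → Fin m → Set
        Trapped s a = Enabled s a × (∀ t → 0ℚ <ℚ Pr s a t → Unranked t)

        Trapped? : ∀ s a → Dec (Trapped s a)
        Trapped? s a = Enabled? s a ×-dec all? λ t → Pr-pos? s a t →-dec ¬? (Good? x (cls t))

        trapped-exit : ∀ {i} → ¬ Good x i → ∃[ s ] ∃[ a ] (cls s ≡ i × EnD cls s a × Trapped s a)
        trapped-exit {i} unranked =
          let s , s∼i , ¬good = counterexample (λ s → cls s ≟ᶠ i) (λ s → all? λ a → EnD? s a →-dec Escapes? x s a) (unranked ∘ stable)
              a , leaving , ¬trapped-exits = counterexample (EnD? s) (Escapes? x s) ¬good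
          in s , a , s∼i , leaving , proj₁ leaving , λ t pos good → ¬trapped-exits (t , pos , good)

        Unranked-class : ∀ {u v} → cls u ≡ cls v → Unranked u → Unranked v
        Unranked-class = subst (λ i → ¬ Good x i)

        EC-trapped : ∀ {E u a} → IsEC E → Unranked u → E u a ≡ true → Trapped u a
        EC-trapped {E} ec unranked e = EC-enabled ec e , λ t pos →
          Unranked-class (inside ec (∈S⁺ E e) (EC-succ ec e pos)) unranked

        trapped-action : ∀ {u} → Unranked u → ∃[ a ] Trapped u a
        trapped-action {u} unranked = from-class (trapped-exit unranked)
          where
          from-class : ∃[ s ] ∃[ a ] (cls s ≡ cls u × EnD cls s a × Trapped s a) → ∃[ a ] Trapped u a
          from-class (s , a , s∼u , _ , trapped) with proj₁ (dm u s) (sym s∼u)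
          ... | inj₁ refl = a , trapped
          ... | inj₂ (E , (ec , _) , u∈ , _) = let a' , e = ∈S⁻ E u∈ in a' , EC-trapped ec unranked e

        Step : Rel (Fin n) 0ℓ
        Step s t = ∃[ a ] (Trapped s a × 0ℚ <ℚ Pr s a t)

        Step? : Decidable₂ Step
        Step? s t = any? λ a → Trapped? s a ×-dec Pr-pos? s a t

        Star? : ∀ y → Decidable (Star Step y)
        Star? = Reachability.Star? Step?

        Unranked-Star : ∀ {u v} → Star Step u v → Unranked u → Unranked v
        Unranked-Star ε unranked = unranked
        Unranked-Star ((a , (_ , trapped) , pos) ◅ p) _ = Unranked-Star p (trapped _ pos)

        bottom : ∀ {y} → Unranked y → ∃[ b ] (Unranked b × ∀ {z} → Star Step b z → Star Step z b)
        bottom {y} = go y (⊂-wellFounded _)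
          where
          go : ∀ y → Acc _⊂_ ⟦ Star? y ⟧ → Unranked y → ∃[ b ] (Unranked b × ∀ {z} → Star Step b z → Star Step z b)
          go y (acc rs) unranked = decide (all? λ z → Star? y z →-dec Star? z y)
            where
            decide : Dec (∀ z → Star Step y z → Star Step z y) → ∃[ b ] (Unranked b × ∀ {z} → Star Step b z → Star Step z b)
            decide (yes returns) = y , unranked , returns _
            decide (no ¬returns) =
              let z , y→z , z↛y = counterexample (Star? y) (λ z → Star? z y) ¬returns
              in go z (rs (⟦⟧-⊂ (Star? z) (Star? y) (y→z ◅◅_) ε z↛y)) (Unranked-Star y→z unranked)

        -- The trapped actions below a bottom state b form an EC containing a class-leaving action.
        module Trap (b : Fin n) (unranked : Unranked b) (returns : ∀ {z} → Star Step b z → Star Step z b) where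

          T : PairSet
          T s a = does (Trapped? s a ×-dec Star? b s)

          T⁺ : ∀ {s a} → Trapped s a → Star Step b s → T s a ≡ true
          T⁺ {s} {a} trapped p = dec-true (Trapped? s a ×-dec Star? b s) (trapped , p)

          T⁻ : ∀ {s a} → T s a ≡ true → Trapped s a × Star Step b s
          T⁻ {s} {a} = does-true (Trapped? s a ×-dec Star? b s)

          T-states : ∀ {s} → Star Step b s → s ∈S T
          T-states p = let a , trapped = trapped-action (Unranked-Star p unranked) in ∈S⁺ T (T⁺ trapped p)

          to-T-path : ∀ {u v} → Star Step b u → Star Step u v → Star (Edge T) u v
          to-T-path p ε = ε
          to-T-path p (edge@(a , trapped , pos) ◅ q) = (a , T⁺ trapped p , pos) ◅ to-T-path (p ◅◅ edge ◅ ε) q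

          T-EC : IsEC T
          T-EC = mkEC {T} (b , ∈S⁻ T (T-states ε)) T-enabled T-closed T-connected
            where
            from-b : ∀ {s} → s ∈S T → Star Step b s
            from-b {s} s∈ = let a , e = ∈S⁻ T s∈ in proj₂ (T⁻ {s} {a} e)
            T-enabled : ∀ {s a} → T s a ≡ true → Enabled s a
            T-enabled {s} {a} e = proj₁ (proj₁ (T⁻ {s} {a} e))
            T-closed : SuccClosed T
            T-closed {s} {a} e pos = let trapped , p = T⁻ {s} {a} e in T-states (p ◅◅ (a , trapped , pos) ◅ ε)
            T-connected : ∀ {s t} → s ∈S T → t ∈S T → Star (Edge T) s t
            T-connected s∈ t∈ = to-T-path (from-b s∈) (returns (from-b s∈)) ◅◅ to-T-path ε (from-b t∈)

          class-reachable : ∀ {s} → cls s ≡ cls b → Star Step b s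
          class-reachable {s} s∼b = go (proj₁ (dm b s) (sym s∼b))
            where
            go : SameMECClass b s → Star Step b s
            go (inj₁ refl) = ε
            go (inj₂ (E , (ec , _) , b∈ , s∈)) = Star.map trapped-edge (EC-connected ec b∈ s∈)
              where
              trapped-edge : ∀ {u v} → Edge E u v → Step u v
              trapped-edge (a , e , pos) =
                a , EC-trapped ec (Unranked-class (inside ec b∈ (∈S⁺ E e)) unranked) e , pos

          absurd : ⊥
          absurd =
            let s , a , s∼b , leaving , trapped = trapped-exit unranked
                t , pos , t≁s = EnD⇒leaves leaving
                e = T⁺ trapped (class-reachable s∼b)
            in t≁s (sym (inside T-EC (∈S⁺ T e) (EC-succ T-EC e pos)))

        all-Good : ∀ i → Good x i
        all-Good i with Good? x i
        ... | yes good = good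
        ... | no unranked =
          let s , _ , s∼i , _ = trapped-exit unranked
              b , unranked-b , returns = bottom {s} (subst (λ j → ¬ Good x j) (sym s∼i) unranked)
          in ⊥-elim (Trap.absurd b unranked-b returns)

      stabilisation : ∃[ x ] Good (suc x) ⊆ Good x
      stabilisation = ascending-chain-stabilises Good Good? Good-step

      rank : Fin k → ℕ
      rank i = μ (λ j → Good? j i) (proj₁ stabilisation)

      rank-good : ∀ i → Good (rank i) i
      rank-good i = μ-witness (λ j → Good? j i) (proj₁ stabilisation)
                              (Stabilised.all-Good (proj₁ stabilisation) (proj₂ stabilisation) i)

      rank-minimal : ∀ {i j} → Good j i → rank i ≤ j
      rank-minimal {i} = μ-minimal (λ j → Good? j i) (proj₁ stabilisation)

      rank-ranking : Ranking rank
      rank-ranking s a leaving = descend (rank (cls s)) (rank-good (cls s))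
        where
        descend : ∀ j → Good j (cls s) → 1 + minList (map (rank ∘ cls) (supp s a)) ≤ j
        descend (suc j) good = let t , pos , good' = good s refl a leaving in
          s≤s (ℕ.≤-trans (minList-≤ (∈-map⁺ (rank ∘ cls) (∈supp⁺ pos))) (rank-minimal good'))

    DMEC⇒certificate : IsDMEC cls → Surjective _≡_ _≡_ cls → MECCert cls
    DMEC⇒certificate dm surj = (λ i → class-certificate dm (proj₂ (surj i) refl)) , rank , rank-ranking
      where open RankingConstruction dm

proposition1 : (M : MDP) (k : ℕ) (cls : Fin (MDP.n M) → Fin k) →
    Surjective _≡_ _≡_ cls →
    (MDPDefs.IsDMEC M cls → MDPDefs.MECCert M cls) × (MDPDefs.MECCert M cls → MDPDefs.IsDMEC M cls)
proposition1 M k cls surj = (λ dm → DMEC⇒certificate dm surj) , certificate⇒DMEC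
  where open MDPTheory.Classes M cls
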